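{- Let $n\ge 1$ and let $F^{(n)}=(F^n_1,F^n_2,F^n_3,\dots)$ be a sequence of positive integers, indexed by $k\ge 1$, such that $F^n_k=1$ for all $k<n$, and which is GCD-morphic, i.e. $\gcd(F^n_k,F^n_l)=F^n_{\gcd(k,l)}$ for all $k,l\ge 1$. Define the sequence $F^{(n+1)}=(F^{n+1}_k)_{k\ge 1}$ by $$F^{n+1}_k=\begin{cases}1, & \text{if } k\le n,\\ \dfrac{F^n_k}{F^n_n}, & \text{if } k>n \text{ and } n\mid k,\\ F^n_k, & \text{otherwise.}\end{cases}$$ Then $F^{(n+1)}$ is a well-defined sequence of positive integers, $F^{(n)}=G_{F^n_n,n}\cdot F^{(n+1)}$ (pointwise product), and $F^{(n+1)}$ is GCD-morphic.
   Context: For a positive integer $c$ and a positive integer $N$, the primary GCD-morphic sequence $G_{c,N}=(g_k)_{k\ge1}$ is defined by $g_k=c$ if $N\mid k$ and $g_k=1$ if $N\nmid k$. A sequence $(F_k)_{k\ge1}$ of positive integers is called GCD-morphic if $\gcd(F_k,F_l)=F_{\gcd(k,l)}$ for all $k,l\ge1$. The product of two sequences is the pointwise product: $(a_k)_k\cdot(b_k)_k=(a_kb_k)_k$. -}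

module Defs where

open import Data.Nat using (ℕ; _≤_; _<_; _*_; _/_; _≤?_; NonZero)
open import Data.Nat.Divisibility using (_∣_; _∣?_)
open import Data.Nat.GCD using (gcd)
open import Relation.Nullary using (yes; no)
open import Relation.Binary.PropositionalEquality using (_≡_)

-- Sequences (F_k)_{k ≥ 1} are modelled as functions ℕ → ℕ; the value at 0 is ignored.
Seq : Set
Seq = ℕ → ℕ

Positive : Seq → Set
Positive F = ∀ k → 1 ≤ k → 0 < F k

GCDMorphic : Seq → Set
GCDMorphic F = ∀ k l → 1 ≤ k → 1 ≤ l → gcd (F k) (F l) ≡ F (gcd k l)

G : ℕ → ℕ → Seq
G c N k with N ∣? k
... | yes _ = c
... | no  _ = 1

_·_ : Seq → Seq → Seq
(a · b) k = a k * b k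

next : (F : Seq) (n : ℕ) → .{{NonZero (F n)}} → Seq
next F n k with k ≤? n
... | yes _ = 1
... | no  _ with n ∣? k
...   | yes _ = F k / F n
...   | no  _ = F k

module Submission where

-- Write c = F n.  Because F is GCD-morphic it preserves divisibility,
-- so c ∣ F k whenever n ∣ k; and because F is 1 below n, gcd (c, F l) = F (gcd (n, l))
-- = 1 whenever n ∤ l (then gcd (n, l) is a proper divisor of n).  Hence F^{(n+1)} is
-- F divided by c exactly on the multiples of n, which gives positivity and the
-- factorisation F = G_{c,n} · F^{(n+1)} at once.  GCD-morphy of F^{(n+1)} follows by
-- splitting on whether n divides k and l, using two facts about gcd of naturals:
--   * dividing both arguments by a common divisor c divides the gcd by c;
--   * dividing one argument by a divisor c coprime to the other leaves the gcd unchanged.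

open import Defs
open import Data.Nat using (ℕ; _≤_; _<_; >-nonZero)
open import Data.Nat.Divisibility using (_∣_)
open import Data.Product using (_×_)
open import Relation.Binary.PropositionalEquality using (_≡_)

open import Data.Nat using (suc; _*_; _/_; _≤?_; NonZero)
open import Data.Nat.Properties using (≤-trans; <⇒≤; ≤-antisym; ≤∧≢⇒<; n≢0⇒n>0; *-identityˡ)
open import Data.Nat.Divisibility using (_∣?_; ∣⇒≤; ∣-antisym; ∣-trans; ∣-refl; ∣1⇒≡1; divides)
open import Data.Nat.DivMod using (n/n≡1; m*[n/m]≡n; m≥n⇒m/n>0)
open import Data.Nat.GCD using (gcd; gcd[m,n]∣m; gcd[m,n]∣n; gcd-greatest; gcd-comm; gcd[m,n]≢0; gcd-GCD; GCD-/; module GCD)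
open import Data.Nat.Coprimality using (gcd≡1⇒coprime; coprime-divisor)
open import Data.Product using (_,_)
open import Data.Sum using (inj₁)
open import Relation.Nullary using (yes; no; ¬_; contradiction)
open import Relation.Binary.PropositionalEquality using (refl; sym; trans; cong; cong₂; subst; module ≡-Reasoning)

-- Dividing one argument of gcd by a divisor c that is coprime to the other argument
-- does not change the gcd: every common divisor of a and b is coprime to c.
gcd-/-coprime : ∀ a b c .{{_ : NonZero c}} → c ∣ a → gcd c b ≡ 1 → gcd (a / c) b ≡ gcd a b
gcd-/-coprime a b c c∣a gcd[c,b]≡1 = ∣-antisym lower upper
  where
  c*[a/c]≡a : c * (a / c) ≡ a
  c*[a/c]≡a = m*[n/m]≡n c∣a

  lower : gcd (a / c) b ∣ gcd a b
  lower = gcd-greatest (∣-trans (gcd[m,n]∣m (a / c) b) (divides c (sym c*[a/c]≡a)))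
                       (gcd[m,n]∣n (a / c) b)

  -- gcd (gcd a b) c divides both c and b, hence divides gcd c b = 1
  d = gcd a b
  gcd[d,c]≡1 : gcd d c ≡ 1
  gcd[d,c]≡1 = ∣1⇒≡1 (subst (gcd d c ∣_) gcd[c,b]≡1
    (gcd-greatest (gcd[m,n]∣n d c) (∣-trans (gcd[m,n]∣m d c) (gcd[m,n]∣n a b))))

  upper : d ∣ gcd (a / c) b
  upper = gcd-greatest
    (coprime-divisor (gcd≡1⇒coprime gcd[d,c]≡1) (subst (d ∣_) (sym c*[a/c]≡a) (gcd[m,n]∣m a b)))
    (gcd[m,n]∣n a b)

gcd-/-common : ∀ a b c .{{_ : NonZero c}} → c ∣ a → c ∣ b → gcd (a / c) (b / c) ≡ gcd a b / c
gcd-/-common a b c c∣a c∣b =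
  GCD.unique (gcd-GCD (a / c) (b / c)) (GCD-/ c∣a c∣b (gcd-greatest c∣a c∣b) (gcd-GCD a b))

gcd-positive : ∀ k l → 1 ≤ k → 1 ≤ gcd k l
gcd-positive (suc k) l _ = n≢0⇒n>0 (gcd[m,n]≢0 (suc k) l (inj₁ (λ ())))

-- A GCD-morphic sequence preserves divisibility: k ∣ l gives gcd k l = k, so
-- F k = gcd (F k) (F l) divides F l.
morphic-∣ : ∀ F → GCDMorphic F → ∀ k l → 1 ≤ k → 1 ≤ l → k ∣ l → F k ∣ F l
morphic-∣ F gm k l 1≤k 1≤l k∣l =
  subst (_∣ F l) (trans (gm k l 1≤k 1≤l) (cong F gcd[k,l]≡k)) (gcd[m,n]∣n (F k) (F l))
  where
  gcd[k,l]≡k : gcd k l ≡ k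
  gcd[k,l]≡k = ∣-antisym (gcd[m,n]∣m k l) (gcd-greatest ∣-refl k∣l)

-- If a GCD-morphic sequence is 1 below n, then F n is coprime to F l for every l
-- not divisible by n, since gcd n l is then a proper divisor of n.
morphic-coprime : ∀ F n → 1 ≤ n → (∀ k → 1 ≤ k → k < n → F k ≡ 1) → GCDMorphic F →
                  ∀ l → 1 ≤ l → ¬ n ∣ l → gcd (F n) (F l) ≡ 1
morphic-coprime F n 1≤n small gm l 1≤l n∤l =
  trans (gm n l 1≤n 1≤l) (small (gcd n l) (gcd-positive n l 1≤n) gcd[n,l]<n)
  where
  gcd[n,l]<n : gcd n l < n
  gcd[n,l]<n = ≤∧≢⇒< (∣⇒≤ {{>-nonZero 1≤n}} (gcd[m,n]∣m n l))
                     (λ gcd≡n → n∤l (subst (_∣ l) gcd≡n (gcd[m,n]∣n n l)))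

-- The two defining equations of `next` on indices k ≥ 1, valid when F is 1 below n:
-- off the multiples of n it agrees with F (for k < n both sides are 1) ...
next-nonmultiple : ∀ F n .{{_ : NonZero (F n)}} → (∀ k → 1 ≤ k → k < n → F k ≡ 1) →
                   ∀ k → 1 ≤ k → ¬ n ∣ k → next F n k ≡ F k
next-nonmultiple F n small k 1≤k n∤k with k ≤? n
... | yes k≤n = sym (small k 1≤k (≤∧≢⇒< k≤n (λ { refl → n∤k ∣-refl })))
... | no _ with n ∣? k
...   | yes n∣k = contradiction n∣k n∤k
...   | no _ = refl

-- ... and on the multiples of n it is F divided by F n (for k = n both sides are 1).
next-multiple : ∀ F n .{{_ : NonZero (F n)}} → ∀ k → 1 ≤ k → n ∣ k → next F n k ≡ F k / F n
next-multiple F n k 1≤k n∣k with k ≤? n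
... | yes k≤n = trans (sym (n/n≡1 (F n))) (cong (λ i → F i / F n) (sym k≡n))
  where
  k≡n : k ≡ n
  k≡n = ≤-antisym k≤n (∣⇒≤ {{>-nonZero 1≤k}} n∣k)
... | no _ with n ∣? k
...   | yes _ = refl
...   | no n∤k = contradiction n∣k n∤k

module Reduction (n : ℕ) (1≤n : 1 ≤ n) (F : Seq) (pos : Positive F)
                 (small : ∀ k → 1 ≤ k → k < n → F k ≡ 1) (gm : GCDMorphic F) where
  instance
    F[n]≢0 : NonZero (F n)
    F[n]≢0 = >-nonZero (pos n 1≤n)

  F[n]∣F : ∀ k → 1 ≤ k → n ∣ k → F n ∣ F k
  F[n]∣F k = morphic-∣ F gm n k 1≤n

  on-multiple : ∀ k → 1 ≤ k → n ∣ k → next F n k ≡ F k / F n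
  on-multiple = next-multiple F n

  off-multiple : ∀ k → 1 ≤ k → ¬ n ∣ k → next F n k ≡ F k
  off-multiple = next-nonmultiple F n small

  -- part 2: on multiples of n, F n ≤ F k makes the quotient F k / F n positive
  next-positive : Positive (next F n)
  next-positive k 1≤k with n ∣? k
  ... | yes n∣k rewrite on-multiple k 1≤k n∣k =
    m≥n⇒m/n>0 (∣⇒≤ {{>-nonZero (pos k 1≤k)}} (F[n]∣F k 1≤k n∣k))
  ... | no n∤k rewrite off-multiple k 1≤k n∤k = pos k 1≤k

  -- part 3: F = G_{F n, n} · next F n, since F n * (F k / F n) = F k when F n ∣ F k
  factorisation : ∀ k → 1 ≤ k → F k ≡ (G (F n) n · next F n) k
  factorisation k 1≤k with n ∣? k
  ... | yes n∣k rewrite on-multiple k 1≤k n∣k = sym (m*[n/m]≡n (F[n]∣F k 1≤k n∣k))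
  ... | no n∤k rewrite off-multiple k 1≤k n∤k = sym (*-identityˡ (F k))

  next-gcd-mixed : ∀ k l → 1 ≤ k → 1 ≤ l → n ∣ k → ¬ n ∣ l →
                   gcd (next F n k) (next F n l) ≡ next F n (gcd k l)
  next-gcd-mixed k l 1≤k 1≤l n∣k n∤l = begin
    gcd (next F n k) (next F n l) ≡⟨ cong₂ gcd (on-multiple k 1≤k n∣k) (off-multiple l 1≤l n∤l) ⟩
    gcd (F k / F n) (F l)         ≡⟨ gcd-/-coprime (F k) (F l) (F n) (F[n]∣F k 1≤k n∣k)
                                       (morphic-coprime F n 1≤n small gm l 1≤l n∤l) ⟩
    gcd (F k) (F l)               ≡⟨ gm k l 1≤k 1≤l ⟩
    F (gcd k l)                   ≡⟨ sym (off-multiple (gcd k l) (gcd-positive k l 1≤k)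
                                       (λ n∣gcd → n∤l (∣-trans n∣gcd (gcd[m,n]∣n k l)))) ⟩
    next F n (gcd k l)            ∎
    where open ≡-Reasoning

  next-morphic : GCDMorphic (next F n)
  next-morphic k l 1≤k 1≤l with n ∣? k | n ∣? l
  ... | yes n∣k | yes n∣l = begin
    gcd (next F n k) (next F n l) ≡⟨ cong₂ gcd (on-multiple k 1≤k n∣k) (on-multiple l 1≤l n∣l) ⟩
    gcd (F k / F n) (F l / F n)   ≡⟨ gcd-/-common (F k) (F l) (F n) (F[n]∣F k 1≤k n∣k) (F[n]∣F l 1≤l n∣l) ⟩
    gcd (F k) (F l) / F n         ≡⟨ cong (_/ F n) (gm k l 1≤k 1≤l) ⟩
    F (gcd k l) / F n             ≡⟨ sym (on-multiple (gcd k l) (gcd-positive k l 1≤k) (gcd-greatest n∣k n∣l)) ⟩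
    next F n (gcd k l)            ∎
    where open ≡-Reasoning
  ... | yes n∣k | no n∤l = next-gcd-mixed k l 1≤k 1≤l n∣k n∤l
  ... | no n∤k | yes n∣l = begin
    gcd (next F n k) (next F n l) ≡⟨ gcd-comm (next F n k) (next F n l) ⟩
    gcd (next F n l) (next F n k) ≡⟨ next-gcd-mixed l k 1≤l 1≤k n∣l n∤k ⟩
    next F n (gcd l k)            ≡⟨ cong (next F n) (gcd-comm l k) ⟩
    next F n (gcd k l)            ∎
    where open ≡-Reasoning
  ... | no n∤k | no n∤l = begin
    gcd (next F n k) (next F n l) ≡⟨ cong₂ gcd (off-multiple k 1≤k n∤k) (off-multiple l 1≤l n∤l) ⟩
    gcd (F k) (F l)               ≡⟨ gm k l 1≤k 1≤l ⟩
    F (gcd k l)                   ≡⟨ sym (off-multiple (gcd k l) (gcd-positive k l 1≤k)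
                                       (λ n∣gcd → n∤k (∣-trans n∣gcd (gcd[m,n]∣m k l)))) ⟩
    next F n (gcd k l)            ∎
    where open ≡-Reasoning

lemma1 : (n : ℕ) (1≤n : 1 ≤ n) (F : Seq) (pos : Positive F)
         → (∀ k → 1 ≤ k → k < n → F k ≡ 1)
         → GCDMorphic F
         → (∀ k → n < k → n ∣ k → F n ∣ F k)
           × Positive (next F n {{>-nonZero (pos n 1≤n)}})
           × (∀ k → 1 ≤ k → F k ≡ (G (F n) n · next F n {{>-nonZero (pos n 1≤n)}}) k)
           × GCDMorphic (next F n {{>-nonZero (pos n 1≤n)}})
lemma1 n 1≤n F pos small gm =
  (λ k n<k → F[n]∣F k (≤-trans 1≤n (<⇒≤ n<k))) , next-positive , factorisation , next-morphic
  where open Reduction n 1≤n F pos small gm
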